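{- For every $n\ge 1$, Snort played on the (initially uncoloured, untinted) graph $G_n$ is a first player win, where $G_n$ is obtained from $T_{n,3}$ by adding four new vertices $L_1, L_2, R_2, R_3$ and the edges $L_1\sim(1,1)$, $L_1\sim(1,2)$, $L_2\sim(1,2)$, $L_2\sim(1,3)$, $L_1\sim L_2$, $(n,1)\sim R_2$, $(n,2)\sim R_2$, $(n,2)\sim R_3$, $(n,3)\sim R_3$, $R_2\sim R_3$.
   Context: Snort is a two-player game (players Left and Right) played on a finite simple graph. The players alternately colour a previously uncoloured vertex, Left in blue and Right in red, subject to the rule that no two adjacent vertices may receive opposite colours. Normal play: a player who cannot move on their turn loses. A game is a "first player win" if the player who moves first has a winning strategy, regardless of whether that player is Left or Right. $T_{n,3}$ is the graph with vertex set $\{(i,j): 1\le i\le n,\ 1\le j\le 3\}$ and edges $(i,j)\sim(i+1,j)$ for $1\le i\le n-1$, $1\le j\le 3$; $(i,j)\sim(i,j+1)$ for $1\le i\le n$, $1\le j\le 2$; and $(i,j)\sim(i+1,j+1)$ for $1\le i\le n-1$, $1\le j\le 2$. -}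

module Defs where

open import Data.Nat using (ℕ; zero; suc; _∸_; _≥_)
open import Data.Fin using (Fin; toℕ)
open import Data.Maybe using (Maybe; just; nothing)
open import Data.Product using (_×_; Σ; ∃; _,_)
open import Data.Sum using (_⊎_)
open import Relation.Binary.PropositionalEquality using (_≡_; _≢_)

data Player : Set where
  Left Right : Player

opp : Player → Player
opp Left  = Right
opp Right = Left

-- A (partial) colouring: nothing = uncoloured, just Left = blue, just Right = red.
Colouring : Set → Set
Colouring V = V → Maybe Player

module Snort {V : Set} (Adj : V → V → Set) where

  Legal : Player → Colouring V → V → Set
  Legal p c v = (c v ≡ nothing) × (∀ w → Adj v w → c w ≢ just (opp p))

  Result : Player → Colouring V → V → Colouring V → Set
  Result p c v c' = (c' v ≡ just p) × (∀ w → w ≢ v → c' w ≡ c w)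

  -- Normal play, defined inductively (well-founded game trees):
  -- Wins p c  : player p, about to move in position c, has a winning strategy.
  data Wins  : Player → Colouring V → Set
  data Loses : Player → Colouring V → Set

  data Wins where
    win : ∀ {p c} (v : V) (c' : Colouring V) →
          Legal p c v → Result p c v c' → Loses (opp p) c' → Wins p c

  data Loses where
    lose : ∀ {p c} →
           (∀ (v : V) (c' : Colouring V) → Legal p c v → Result p c v c' →
              Wins (opp p) c') →
           Loses p c

  empty : Colouring V
  empty _ = nothing

  FirstPlayerWin : Set
  FirstPlayerWin = Wins Left empty × Wins Right empty

-- The graph G_n.  Grid vertex (i,j) of the paper (1 ≤ i ≤ n, 1 ≤ j ≤ 3)
-- is  grid i' j'  with toℕ i' = i - 1, toℕ j' = j - 1.

data GV (n : ℕ) : Set where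
  grid : Fin n → Fin 3 → GV n
  L1 L2 R2 R3 : GV n

-- Directed edge list (each undirected edge listed once).
data Edge (n : ℕ) : GV n → GV n → Set where
  vert : ∀ {i i' j} → toℕ i' ≡ suc (toℕ i) → Edge n (grid i j) (grid i' j)
  horz : ∀ {i j j'} → toℕ j' ≡ suc (toℕ j) → Edge n (grid i j) (grid i j')
  diag : ∀ {i i' j j'} → toℕ i' ≡ suc (toℕ i) → toℕ j' ≡ suc (toℕ j) →
         Edge n (grid i j) (grid i' j')
  l1-11 : ∀ {i j} → toℕ i ≡ 0 → toℕ j ≡ 0 → Edge n L1 (grid i j)
  l1-12 : ∀ {i j} → toℕ i ≡ 0 → toℕ j ≡ 1 → Edge n L1 (grid i j)
  l2-12 : ∀ {i j} → toℕ i ≡ 0 → toℕ j ≡ 1 → Edge n L2 (grid i j)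
  l2-13 : ∀ {i j} → toℕ i ≡ 0 → toℕ j ≡ 2 → Edge n L2 (grid i j)
  l1-l2 : Edge n L1 L2
  r2-n1 : ∀ {i j} → toℕ i ≡ n ∸ 1 → toℕ j ≡ 0 → Edge n R2 (grid i j)
  r2-n2 : ∀ {i j} → toℕ i ≡ n ∸ 1 → toℕ j ≡ 1 → Edge n R2 (grid i j)
  r3-n2 : ∀ {i j} → toℕ i ≡ n ∸ 1 → toℕ j ≡ 1 → Edge n R3 (grid i j)
  r3-n3 : ∀ {i j} → toℕ i ≡ n ∸ 1 → toℕ j ≡ 2 → Edge n R3 (grid i j)
  r2-r3 : Edge n R2 R3

Adj : (n : ℕ) → GV n → GV n → Set
Adj n u v = Edge n u v ⊎ Edge n v u

{-# OPTIONS --safe #-}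
-- The point reflection (i , j) ↦ (n + 1 − i , 4 − j), L₁ ↔ R₃, L₂ ↔ R₂ is an
-- automorphism of G_n.  The first player colours the centre a = (⌊(n+1)/2⌋ , 2),
-- which is fixed by the reflection when n is odd and adjacent to its image when
-- n is even, and from then on answers every move of the opponent at v by
-- colouring the image of v.  Since a and its image are the only vertices that
-- are fixed by the reflection or adjacent to their image, the colouring stays
-- mirrored (with colours swapped) and every reply is legal; as the board is
-- finite, the opponent eventually has no move left.
module Submission where

open import Defs
open import Data.Nat using (ℕ; zero; suc; _+_; _∸_; _≤_; _<_; _≥_; z≤n; s≤s; ⌊_/2⌋; ⌈_/2⌉)
open import Data.Nat.Properties
  using ( ≤-refl; <-trans; +-mono-≤; +-mono-<-≤; +-mono-≤-<; +-suc; +-cancelˡ-≡; m+[n∸m]≡n; n∸n≡0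
        ; ⌊n/2⌋≤n; ⌊n/2⌋+⌈n/2⌉≡n; n≡⌊n+n/2⌋; n≡⌈n+n/2⌉ )
open import Data.Nat.Induction using (<-wellFounded)
open import Data.Nat.ListAction using (sum)
open import Data.Fin using (Fin; zero; suc; toℕ; fromℕ<; opposite)
open import Data.Fin.Properties
  using (toℕ-injective; toℕ-fromℕ<; opposite-prop; opposite-involutive; toℕ≤pred[n])
  renaming (_≟_ to _≟ᶠ_)
open import Data.List using (List; []; _∷_; _++_; map; allFin; cartesianProductWith)
open import Data.List.Relation.Unary.Any using (here; there)
open import Data.List.Membership.Propositional using (_∈_)
open import Data.List.Membership.Propositional.Properties
  using (∈-++⁺ˡ; ∈-++⁺ʳ; ∈-allFin; ∈-cartesianProductWith⁺)
open import Data.Maybe using (Maybe; just; nothing) renaming (map to mapᵐ)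
open import Data.Product using (_×_; _,_; proj₁; proj₂)
open import Data.Product.Properties using () renaming (≡-dec to ×-≡-dec)
open import Data.Sum as Sum using (_⊎_; inj₁; inj₂; [_,_]′)
open import Data.Sum.Properties using () renaming (≡-dec to ⊎-≡-dec)
open import Data.Empty using (⊥)
open import Function using (_∘_)
open import Induction.WellFounded using (Acc; acc)
open import Relation.Nullary using (¬_; yes; no; contradiction)
open import Relation.Nullary.Decidable using (map′)
open import Relation.Binary.Definitions using (DecidableEquality)
open import Relation.Binary.PropositionalEquality
  using (_≡_; _≢_; refl; sym; trans; cong; cong₂; subst; module ≡-Reasoning)

opp-involutive : ∀ p → opp (opp p) ≡ p
opp-involutive Left  = refl
opp-involutive Right = refl

just≢just-opp : ∀ p → just p ≢ just (opp p)
just≢just-opp Left  ()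
just≢just-opp Right ()

module _ {A : Set} where

  sum-map-mono : ∀ {f g : A → ℕ} xs → (∀ x → f x ≤ g x) → sum (map f xs) ≤ sum (map g xs)
  sum-map-mono []       f≤g = z≤n
  sum-map-mono (x ∷ xs) f≤g = +-mono-≤ (f≤g x) (sum-map-mono xs f≤g)

  sum-map-mono-< : ∀ {f g : A → ℕ} {y} xs → (∀ x → f x ≤ g x) → y ∈ xs → f y < g y →
                   sum (map f xs) < sum (map g xs)
  sum-map-mono-< (x ∷ xs) f≤g (here refl) fy<gy = +-mono-<-≤ fy<gy (sum-map-mono xs f≤g)
  sum-map-mono-< (x ∷ xs) f≤g (there y∈xs) fy<gy = +-mono-≤-< (f≤g x) (sum-map-mono-< xs f≤g y∈xs fy<gy)

-- The vertices at which the mirrored reply along σ may be illegal.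
Central : {V : Set} → (V → V → Set) → (V → V) → V → Set
Central Adj σ v = σ v ≡ v ⊎ Adj v (σ v)

module MirrorStrategy
  {V : Set} (Adj : V → V → Set) (_≟_ : DecidableEquality V)
  (vertices : List V) (∈-vertices : ∀ v → v ∈ vertices)
  (σ : V → V) (σ-involutive : ∀ v → σ (σ v) ≡ v) (σ-adj : ∀ {u w} → Adj u w → Adj (σ u) (σ w))
  (a : V) (a-central : Central Adj σ a) (central⇒a : ∀ v → Central Adj σ v → v ≡ a ⊎ v ≡ σ a)
  where

  open Snort Adj

  σ-shift : ∀ {u w} → σ u ≡ w → u ≡ σ w
  σ-shift {u} σu≡w = trans (sym (σ-involutive u)) (cong σ σu≡w)

  σ-injective : ∀ {u w} → σ u ≡ σ w → u ≡ w
  σ-injective {u} {w} σu≡σw = trans (σ-shift σu≡σw) (σ-involutive w)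

  blank : Maybe Player → ℕ
  blank nothing  = 1
  blank (just _) = 0

  uncoloured : Colouring V → ℕ
  uncoloured c = sum (map (blank ∘ c) vertices)

  uncoloured-decreases : ∀ {p c v c'} → c v ≡ nothing → Result p c v c' → uncoloured c' < uncoloured c
  uncoloured-decreases {p} {c} {v} {c'} cv≡nothing (c'v≡p , unchanged) =
    sum-map-mono-< vertices blank-≤ (∈-vertices v) blank-<
    where
    blank-≤ : ∀ w → blank (c' w) ≤ blank (c w)
    blank-≤ w with w ≟ v
    ... | yes refl rewrite c'v≡p = z≤n
    ... | no w≢v rewrite unchanged w w≢v = ≤-refl
    blank-< : blank (c' v) < blank (c v)
    blank-< rewrite c'v≡p | cv≡nothing = s≤s z≤n

  paint : Colouring V → V → Player → Colouring V
  paint c v p w with w ≟ v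
  ... | yes _ = just p
  ... | no  _ = c w

  painted : ∀ c v p → Result p c v (paint c v p)
  painted c v p = at-v , elsewhere
    where
    at-v : paint c v p v ≡ just p
    at-v with v ≟ v
    ... | yes _   = refl
    ... | no v≢v = contradiction refl v≢v
    elsewhere : ∀ w → w ≢ v → paint c v p w ≡ c w
    elsewhere w w≢v with w ≟ v
    ... | yes w≡v = contradiction w≡v w≢v
    ... | no _    = refl

  record Mirrored (p : Player) (c : Colouring V) : Set where
    field
      centre-owned : c a ≡ just p
      image-safe   : c (σ a) ≢ just (opp p)
      mirrored     : ∀ w → w ≢ a → w ≢ σ a → c (σ w) ≡ mapᵐ opp (c w)
  open Mirrored

  mirror-opponent : ∀ {p c w} → Mirrored p c → c w ≡ just (opp p) → c (σ w) ≡ just (opp (opp p))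
  mirror-opponent {p} {c} {w} m cw≡opp with w ≟ a | w ≟ σ a
  ... | yes refl | _        = contradiction (trans (sym (centre-owned m)) cw≡opp) (just≢just-opp p)
  ... | no _     | yes refl = contradiction cw≡opp (image-safe m)
  ... | no w≢a   | no w≢σa  = trans (mirrored m w w≢a w≢σa) (cong (mapᵐ opp) cw≡opp)

  opponent-avoids-centre : ∀ {p c v} → Mirrored p c → Legal (opp p) c v → v ≢ a × v ≢ σ a
  opponent-avoids-centre {p} {c} {v} m (cv≡nothing , v-safe) = v≢a , v≢σa
    where
    v≢a : v ≢ a
    v≢a refl with trans (sym cv≡nothing) (centre-owned m)
    ... | ()
    v≢σa : v ≢ σ a
    v≢σa refl = [ v≢a , a-threatens ]′ a-central
      where
      a-threatens : Adj a (σ a) → ⊥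
      a-threatens adj = v-safe a (subst (Adj (σ a)) (σ-involutive a) (σ-adj adj))
        (trans (centre-owned m) (cong just (sym (opp-involutive p))))

  not-central : ∀ {v} → v ≢ a → v ≢ σ a → ¬ Central Adj σ v
  not-central v≢a v≢σa v-central = [ v≢a , v≢σa ]′ (central⇒a _ v-central)

  reply-legal : ∀ {p c v c'} → Mirrored p c → Legal (opp p) c v → Result (opp p) c v c' →
                Legal p c' (σ v)
  reply-legal {p} {c} {v} {c'} m legal@(cv≡nothing , v-safe) (_ , unchanged)
    with opponent-avoids-centre m legal
  ... | v≢a , v≢σa = σv-blank , σv-safe
    where
    σv≢v : σ v ≢ v
    σv≢v = not-central v≢a v≢σa ∘ inj₁
    σv-blank : c' (σ v) ≡ nothing
    σv-blank = trans (unchanged (σ v) σv≢v) (trans (mirrored m v v≢a v≢σa) (cong (mapᵐ opp) cv≡nothing))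
    σv-safe : ∀ w → Adj (σ v) w → c' w ≢ just (opp p)
    σv-safe w adj with w ≟ v
    ... | yes refl = λ _ →
      not-central v≢a v≢σa (inj₂ (subst (λ u → Adj u (σ w)) (σ-involutive w) (σ-adj adj)))
    ... | no w≢v = λ c'w≡opp →
      v-safe (σ w) (subst (λ u → Adj u (σ w)) (σ-involutive v) (σ-adj adj))
        (mirror-opponent m (trans (sym (unchanged w w≢v)) c'w≡opp))

  reply-mirrored : ∀ {p c v c' c''} → Mirrored p c → v ≢ a → v ≢ σ a →
                   Result (opp p) c v c' → Result p c' (σ v) c'' → Mirrored p c''
  reply-mirrored {p} {c} {v} {c'} {c''} m v≢a v≢σa (c'v≡opp , c'-unchanged) (c''σv≡p , c''-unchanged) =
    record
      { centre-owned = trans (elsewhere a (v≢a ∘ sym) (v≢σa ∘ σ-shift ∘ sym)) (centre-owned m)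
      ; image-safe   = image-safe m ∘ trans (sym (elsewhere (σ a) (v≢σa ∘ sym) (v≢a ∘ sym ∘ σ-injective)))
      ; mirrored     = mirrored″
      }
    where
    open ≡-Reasoning
    σv≢v : σ v ≢ v
    σv≢v = not-central v≢a v≢σa ∘ inj₁
    elsewhere : ∀ w → w ≢ v → w ≢ σ v → c'' w ≡ c w
    elsewhere w w≢v w≢σv = trans (c''-unchanged w w≢σv) (c'-unchanged w w≢v)
    c''v≡opp : c'' v ≡ just (opp p)
    c''v≡opp = trans (c''-unchanged v (σv≢v ∘ sym)) c'v≡opp
    mirrored″ : ∀ w → w ≢ a → w ≢ σ a → c'' (σ w) ≡ mapᵐ opp (c'' w)
    mirrored″ w w≢a w≢σa with w ≟ v | w ≟ σ v
    ... | yes refl | _ = begin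
      c'' (σ v)                ≡⟨ c''σv≡p ⟩
      just p                   ≡⟨ cong just (sym (opp-involutive p)) ⟩
      just (opp (opp p))       ≡⟨ cong (mapᵐ opp) (sym c''v≡opp) ⟩
      mapᵐ opp (c'' v)         ∎
    ... | no _ | yes refl = begin
      c'' (σ (σ v))            ≡⟨ cong c'' (σ-involutive v) ⟩
      c'' v                    ≡⟨ c''v≡opp ⟩
      just (opp p)             ≡⟨ cong (mapᵐ opp) (sym c''σv≡p) ⟩
      mapᵐ opp (c'' (σ v))     ∎
    ... | no w≢v | no w≢σv = begin
      c'' (σ w)                ≡⟨ elsewhere (σ w) (w≢σv ∘ σ-shift) (w≢v ∘ σ-injective) ⟩
      c (σ w)                  ≡⟨ mirrored m w w≢a w≢σa ⟩
      mapᵐ opp (c w)           ≡⟨ cong (mapᵐ opp) (sym (elsewhere w w≢v w≢σv)) ⟩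
      mapᵐ opp (c'' w)         ∎

  mirror-loses : ∀ {p c} → Mirrored p c → Acc _<_ (uncoloured c) → Loses (opp p) c
  mirror-loses {p} {c} m (acc smaller) = lose reply
    where
    reply : ∀ v c' → Legal (opp p) c v → Result (opp p) c v c' → Wins (opp (opp p)) c'
    reply v c' legal played with opponent-avoids-centre m legal
    ... | v≢a , v≢σa = subst (λ q → Wins q c') (sym (opp-involutive p))
      (win (σ v) c'' σv-legal replied
        (mirror-loses (reply-mirrored m v≢a v≢σa played replied) (smaller fewer)))
      where
      c'' : Colouring V
      c'' = paint c' (σ v) p
      replied : Result p c' (σ v) c''
      replied = painted c' (σ v) p
      σv-legal : Legal p c' (σ v)
      σv-legal = reply-legal m legal played
      fewer : uncoloured c'' < uncoloured c
      fewer = <-trans (uncoloured-decreases (proj₁ σv-legal) replied)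
                      (uncoloured-decreases (proj₁ legal) played)

  opening : ∀ p → Mirrored p (paint empty a p)
  opening p = record
    { centre-owned = a-painted
    ; image-safe   = image-safe′
    ; mirrored     = λ w w≢a w≢σa →
        trans (unpainted (σ w) (w≢σa ∘ σ-shift)) (cong (mapᵐ opp) (sym (unpainted w w≢a)))
    }
    where
    a-painted : paint empty a p a ≡ just p
    a-painted = proj₁ (painted empty a p)
    unpainted : ∀ w → w ≢ a → paint empty a p w ≡ nothing
    unpainted = proj₂ (painted empty a p)
    image-safe′ : paint empty a p (σ a) ≢ just (opp p)
    image-safe′ with σ a ≟ a
    ... | yes _ = just≢just-opp p
    ... | no _  = λ ()

  firstPlayerWin : FirstPlayerWin
  firstPlayerWin = first-player-wins Left , first-player-wins Right
    where
    first-player-wins : ∀ p → Wins p empty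
    first-player-wins p = win a (paint empty a p) (refl , λ _ _ ()) (painted empty a p)
      (mirror-loses (opening p) (<-wellFounded _))

⌈n/2⌉≡⌊n/2⌋⊎1+⌊n/2⌋ : ∀ n → ⌈ n /2⌉ ≡ ⌊ n /2⌋ ⊎ ⌈ n /2⌉ ≡ suc ⌊ n /2⌋
⌈n/2⌉≡⌊n/2⌋⊎1+⌊n/2⌋ zero          = inj₁ refl
⌈n/2⌉≡⌊n/2⌋⊎1+⌊n/2⌋ (suc zero)    = inj₂ refl
⌈n/2⌉≡⌊n/2⌋⊎1+⌊n/2⌋ (suc (suc n)) = Sum.map (cong suc) (cong suc) (⌈n/2⌉≡⌊n/2⌋⊎1+⌊n/2⌋ n)

module _ {n : ℕ} where

  open ≡-Reasoning

  toℕ+toℕ-opposite : (i : Fin (suc n)) → toℕ i + toℕ (opposite i) ≡ n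
  toℕ+toℕ-opposite i = trans (cong (toℕ i +_) (opposite-prop i)) (m+[n∸m]≡n (toℕ≤pred[n] i))

  toℕ-opposite : ∀ {k} (i : Fin (suc n)) → toℕ i ≡ k → toℕ (opposite i) ≡ n ∸ k
  toℕ-opposite i refl = opposite-prop i

  toℕ-opposite-last : (i : Fin (suc n)) → toℕ i ≡ n → toℕ (opposite i) ≡ 0
  toℕ-opposite-last i i≡n = trans (toℕ-opposite i i≡n) (n∸n≡0 n)

  opposite-reverses-successor : ∀ {i i' : Fin (suc n)} → toℕ i' ≡ suc (toℕ i) →
                                toℕ (opposite i) ≡ suc (toℕ (opposite i'))
  opposite-reverses-successor {i} {i'} i'≡1+i = +-cancelˡ-≡ (toℕ i) _ _ (begin
    toℕ i + toℕ (opposite i)          ≡⟨ toℕ+toℕ-opposite i ⟩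
    n                                 ≡⟨ toℕ+toℕ-opposite i' ⟨
    toℕ i' + toℕ (opposite i')        ≡⟨ cong (_+ toℕ (opposite i')) i'≡1+i ⟩
    suc (toℕ i) + toℕ (opposite i')   ≡⟨ +-suc (toℕ i) (toℕ (opposite i')) ⟨
    toℕ i + suc (toℕ (opposite i'))   ∎)

  centre : Fin (suc n)
  centre = fromℕ< (s≤s (⌊n/2⌋≤n n))

  toℕ-centre : toℕ centre ≡ ⌊ n /2⌋
  toℕ-centre = toℕ-fromℕ< (s≤s (⌊n/2⌋≤n n))

  ⌊toℕ+toℕ-opposite/2⌋ : (i : Fin (suc n)) → ⌊ toℕ i + toℕ (opposite i) /2⌋ ≡ toℕ centre
  ⌊toℕ+toℕ-opposite/2⌋ i = trans (cong ⌊_/2⌋ (toℕ+toℕ-opposite i)) (sym toℕ-centre)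

  opposite-fixed⇒centre : ∀ {i : Fin (suc n)} → opposite i ≡ i → i ≡ centre
  opposite-fixed⇒centre {i} fixed = toℕ-injective (begin
    toℕ i                                ≡⟨ n≡⌊n+n/2⌋ (toℕ i) ⟩
    ⌊ toℕ i + toℕ i /2⌋                  ≡⟨ cong (λ k → ⌊ toℕ i + toℕ k /2⌋) fixed ⟨
    ⌊ toℕ i + toℕ (opposite i) /2⌋       ≡⟨ ⌊toℕ+toℕ-opposite/2⌋ i ⟩
    toℕ centre                           ∎)

  opposite-successor⇒centre : ∀ {i : Fin (suc n)} → toℕ (opposite i) ≡ suc (toℕ i) → i ≡ centre
  opposite-successor⇒centre {i} successor = toℕ-injective (begin
    toℕ i                                ≡⟨ n≡⌈n+n/2⌉ (toℕ i) ⟩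
    ⌊ suc (toℕ i + toℕ i) /2⌋            ≡⟨ cong ⌊_/2⌋ (+-suc (toℕ i) (toℕ i)) ⟨
    ⌊ toℕ i + suc (toℕ i) /2⌋            ≡⟨ cong (λ k → ⌊ toℕ i + k /2⌋) successor ⟨
    ⌊ toℕ i + toℕ (opposite i) /2⌋       ≡⟨ ⌊toℕ+toℕ-opposite/2⌋ i ⟩
    toℕ centre                           ∎)

  toℕ-opposite-centre : toℕ (opposite centre) ≡ ⌈ n /2⌉
  toℕ-opposite-centre = +-cancelˡ-≡ ⌊ n /2⌋ _ _ (begin
    ⌊ n /2⌋ + toℕ (opposite centre)    ≡⟨ cong (_+ toℕ (opposite centre)) toℕ-centre ⟨
    toℕ centre + toℕ (opposite centre) ≡⟨ toℕ+toℕ-opposite centre ⟩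
    n                                  ≡⟨ ⌊n/2⌋+⌈n/2⌉≡n n ⟨
    ⌊ n /2⌋ + ⌈ n /2⌉                  ∎)

  opposite-centre : opposite centre ≡ centre ⊎ toℕ (opposite centre) ≡ suc (toℕ centre)
  opposite-centre with ⌈n/2⌉≡⌊n/2⌋⊎1+⌊n/2⌋ n
  ... | inj₁ ⌈n/2⌉≡⌊n/2⌋ =
    inj₁ (toℕ-injective (trans toℕ-opposite-centre (trans ⌈n/2⌉≡⌊n/2⌋ (sym toℕ-centre))))
  ... | inj₂ ⌈n/2⌉≡1+⌊n/2⌋ =
    inj₂ (trans toℕ-opposite-centre (trans ⌈n/2⌉≡1+⌊n/2⌋ (cong suc (sym toℕ-centre))))

toℕ-opposite≢1+toℕ : (j : Fin 3) → toℕ (opposite j) ≢ suc (toℕ j)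
toℕ-opposite≢1+toℕ zero             ()
toℕ-opposite≢1+toℕ (suc zero)       ()
toℕ-opposite≢1+toℕ (suc (suc zero)) ()

encode : ∀ {n} → GV n → (Fin n × Fin 3) ⊎ Fin 4
encode (grid i j) = inj₁ (i , j)
encode L1         = inj₂ zero
encode L2         = inj₂ (suc zero)
encode R2         = inj₂ (suc (suc zero))
encode R3         = inj₂ (suc (suc (suc zero)))

decode : ∀ {n} → (Fin n × Fin 3) ⊎ Fin 4 → GV n
decode (inj₁ (i , j))              = grid i j
decode (inj₂ zero)                 = L1
decode (inj₂ (suc zero))           = L2
decode (inj₂ (suc (suc zero)))     = R2
decode (inj₂ (suc (suc (suc _)))) = R3

decode-encode : ∀ {n} (v : GV n) → decode (encode v) ≡ v
decode-encode (grid i j) = refl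
decode-encode L1         = refl
decode-encode L2         = refl
decode-encode R2         = refl
decode-encode R3         = refl

encode-injective : ∀ {n} {u v : GV n} → encode u ≡ encode v → u ≡ v
encode-injective {u = u} {v} eu≡ev =
  trans (sym (decode-encode u)) (trans (cong decode eu≡ev) (decode-encode v))

_≟ⱽ_ : ∀ {n} → DecidableEquality (GV n)
u ≟ⱽ v = map′ encode-injective (cong encode) (⊎-≡-dec (×-≡-dec _≟ᶠ_ _≟ᶠ_) _≟ᶠ_ (encode u) (encode v))

grid-vertices : ∀ n → List (GV n)
grid-vertices n = cartesianProductWith grid (allFin n) (allFin 3)

vertices : ∀ n → List (GV n)
vertices n = grid-vertices n ++ L1 ∷ L2 ∷ R2 ∷ R3 ∷ []

∈-vertices : ∀ {n} (v : GV n) → v ∈ vertices n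
∈-vertices (grid i j) = ∈-++⁺ˡ (∈-cartesianProductWith⁺ grid (∈-allFin i) (∈-allFin j))
∈-vertices {n} L1     = ∈-++⁺ʳ (grid-vertices n) (here refl)
∈-vertices {n} L2     = ∈-++⁺ʳ (grid-vertices n) (there (here refl))
∈-vertices {n} R2     = ∈-++⁺ʳ (grid-vertices n) (there (there (here refl)))
∈-vertices {n} R3     = ∈-++⁺ʳ (grid-vertices n) (there (there (there (here refl))))

grid-injective : ∀ {n} {i i' : Fin n} {j j'} → grid i j ≡ grid i' j' → i ≡ i' × j ≡ j'
grid-injective refl = refl , refl

module _ {n : ℕ} where

  reflect : GV (suc n) → GV (suc n)
  reflect (grid i j) = grid (opposite i) (opposite j)
  reflect L1         = R3
  reflect L2         = R2
  reflect R2         = L2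
  reflect R3         = L1

  reflect-involutive : ∀ v → reflect (reflect v) ≡ v
  reflect-involutive (grid i j) = cong₂ grid (opposite-involutive i) (opposite-involutive j)
  reflect-involutive L1         = refl
  reflect-involutive L2         = refl
  reflect-involutive R2         = refl
  reflect-involutive R3         = refl

  reflect-edge : ∀ {u w} → Edge (suc n) u w → Adj (suc n) (reflect u) (reflect w)
  reflect-edge (vert i'≡1+i)             = inj₂ (vert (opposite-reverses-successor i'≡1+i))
  reflect-edge (horz j'≡1+j)             = inj₂ (horz (opposite-reverses-successor j'≡1+j))
  reflect-edge (diag i'≡1+i j'≡1+j)      =
    inj₂ (diag (opposite-reverses-successor i'≡1+i) (opposite-reverses-successor j'≡1+j))
  reflect-edge (l1-11 {i} {j} i≡0 j≡0)   = inj₁ (r3-n3 (toℕ-opposite i i≡0) (toℕ-opposite j j≡0))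
  reflect-edge (l1-12 {i} {j} i≡0 j≡1)   = inj₁ (r3-n2 (toℕ-opposite i i≡0) (toℕ-opposite j j≡1))
  reflect-edge (l2-12 {i} {j} i≡0 j≡1)   = inj₁ (r2-n2 (toℕ-opposite i i≡0) (toℕ-opposite j j≡1))
  reflect-edge (l2-13 {i} {j} i≡0 j≡2)   = inj₁ (r2-n1 (toℕ-opposite i i≡0) (toℕ-opposite j j≡2))
  reflect-edge l1-l2                     = inj₂ r2-r3
  reflect-edge (r2-n1 {i} {j} i≡n j≡0)   = inj₁ (l2-13 (toℕ-opposite-last i i≡n) (toℕ-opposite j j≡0))
  reflect-edge (r2-n2 {i} {j} i≡n j≡1)   = inj₁ (l2-12 (toℕ-opposite-last i i≡n) (toℕ-opposite j j≡1))
  reflect-edge (r3-n2 {i} {j} i≡n j≡1)   = inj₁ (l1-12 (toℕ-opposite-last i i≡n) (toℕ-opposite j j≡1))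
  reflect-edge (r3-n3 {i} {j} i≡n j≡2)   = inj₁ (l1-11 (toℕ-opposite-last i i≡n) (toℕ-opposite j j≡2))
  reflect-edge r2-r3                     = inj₂ l1-l2

  reflect-adj : ∀ {u w} → Adj (suc n) u w → Adj (suc n) (reflect u) (reflect w)
  reflect-adj (inj₁ uw) = reflect-edge uw
  reflect-adj (inj₂ wu) = Sum.swap (reflect-edge wu)

  -- Indices are 0-based and the graph is G_(n+1): this is a = (⌊(n+2)/2⌋ , 2) of the paper.
  middle : GV (suc n)
  middle = grid centre centre

  middle-central : Central (Adj (suc n)) reflect middle
  middle-central with opposite-centre {n}
  ... | inj₁ fixed     = inj₁ (cong (λ i → grid i centre) fixed)
  ... | inj₂ successor = inj₂ (inj₁ (vert successor))

  reflect-fixed⇒middle : ∀ {v} → reflect v ≡ v → v ≡ middle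
  reflect-fixed⇒middle {grid i j} fixed with grid-injective fixed
  ... | i-fixed , j-fixed = cong₂ grid (opposite-fixed⇒centre i-fixed) (opposite-fixed⇒centre j-fixed)

  edge-to-reflection⇒middle : ∀ {u w} → Edge (suc n) u w → w ≡ reflect u → u ≡ middle
  edge-to-reflection⇒middle (vert i'≡1+i) w≡ru with grid-injective w≡ru
  ... | i'≡oi , j≡oj = cong₂ grid (opposite-successor⇒centre (trans (cong toℕ (sym i'≡oi)) i'≡1+i))
                                  (opposite-fixed⇒centre (sym j≡oj))
  edge-to-reflection⇒middle (horz {j = j} j'≡1+j) w≡ru =
    contradiction (trans (cong toℕ (sym (proj₂ (grid-injective w≡ru)))) j'≡1+j) (toℕ-opposite≢1+toℕ j)
  edge-to-reflection⇒middle (diag {j = j} _ j'≡1+j) w≡ru =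
    contradiction (trans (cong toℕ (sym (proj₂ (grid-injective w≡ru)))) j'≡1+j) (toℕ-opposite≢1+toℕ j)

  central⇒middle : ∀ v → Central (Adj (suc n)) reflect v → v ≡ middle ⊎ v ≡ reflect middle
  central⇒middle v (inj₁ fixed)    = inj₁ (reflect-fixed⇒middle fixed)
  central⇒middle v (inj₂ (inj₁ e)) = inj₁ (edge-to-reflection⇒middle e refl)
  central⇒middle v (inj₂ (inj₂ e)) =
    inj₂ (trans (sym (reflect-involutive v))
                (cong reflect (edge-to-reflection⇒middle e (sym (reflect-involutive v)))))

lemma3p4 : (n : ℕ) → n ≥ 1 → Snort.FirstPlayerWin (Adj n)
lemma3p4 (suc n) _ =
  MirrorStrategy.firstPlayerWin (Adj (suc n)) _≟ⱽ_ (vertices (suc n)) ∈-vertices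
    reflect reflect-involutive reflect-adj middle middle-central central⇒middle
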